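{- Let $a,b\ge1$, $P=[a]\times[b]$, and let $\Phi_J:J(P)\to J(P)$ be rowmotion. Let $I\in J(P)$ have sign-word $w$, and let $\tilde w$ be the block-gap reversal of $w$. Then the sign-word of $\Phi_J(I)$ is $\tilde w$.
   Context: $[a]\times[b]$ has the product order of the chains $[a]=\{1<\dots<a\}$, $[b]$. $J(P)$ is the set of order ideals (down-closed subsets). Rowmotion $\Phi_J(I)$ is the order ideal generated by the set of minimal elements of $P\setminus I$. The height function of $I$ is $h_I(k)=|k|+2\,\#\{(i,j)\in I: j-i=k\}$ for integers $-a\le k\le b$; the sign-word of $I$ is the word $w\in\{ -1,+1\}^{a+b}$ whose $i$th letter is $h_I(i-a)-h_I(i-a-1)$ for $1\le i\le a+b$ (it has $a$ letters $-1$ and $b$ letters $+1$, and determines $I$). For a word $w\in\{ -1,+1\}^n$, a block is an occurrence of the factor $-1,+1$ (consecutive letters); distinct blocks do not overlap, and the letters not in blocks form maximal contiguous factors, called gaps, each of the form $+1,\dots,+1,-1,\dots,-1$. This gives a unique decomposition of $w$ into consecutive blocks and gaps. The block-gap reversal $\tilde w$ is obtained by reversing each block and each gap in place, keeping the factors in the same order. -}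

module Defs where

open import Data.Bool using (Bool; true; false; _∧_; not; if_then_else_)
open import Data.Nat as ℕ using (ℕ; zero; suc; _≤ᵇ_)
open import Data.Integer as ℤ using (ℤ; +_; -[1+_]; _-_; ∣_∣)
open import Data.Fin using (Fin; toℕ)
open import Data.List using (List; []; _∷_; _++_; map; upTo; allFin; concatMap)
open import Data.Bool.ListAction using (any; all)
open import Data.Nat.ListAction using (sum)
open import Data.Product using (_×_; _,_)
open import Relation.Nullary.Decidable using (⌊_⌋)
open import Relation.Binary.PropositionalEquality using (_≡_)

-- The poset [a] × [b]: element (i , j) : Fin a × Fin b stands for the pair
-- (toℕ i + 1 , toℕ j + 1) of [a] × [b].
Pt : ℕ → ℕ → Set
Pt a b = Fin a × Fin b

_≤P_ : ∀ {a b} → Pt a b → Pt a b → Bool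
(i , j) ≤P (i' , j') = (toℕ i ≤ᵇ toℕ i') ∧ (toℕ j ≤ᵇ toℕ j')

_<P_ : ∀ {a b} → Pt a b → Pt a b → Bool
(i , j) <P (i' , j') =
  ((i , j) ≤P (i' , j')) ∧ not (⌊ toℕ i ℕ.≟ toℕ i' ⌋ ∧ ⌊ toℕ j ℕ.≟ toℕ j' ⌋)

points : (a b : ℕ) → List (Pt a b)
points a b = concatMap (λ i → map (λ j → (i , j)) (allFin b)) (allFin a)

Subset : ℕ → ℕ → Set
Subset a b = Pt a b → Bool

IsOrderIdeal : ∀ {a b} → Subset a b → Set
IsOrderIdeal {a} {b} I = ∀ (p q : Pt a b) → (q ≤P p) ≡ true → I p ≡ true → I q ≡ true

isMinCompl : ∀ {a b} → Subset a b → Pt a b → Bool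
isMinCompl {a} {b} I m = not (I m) ∧ all (λ p → if p <P m then I p else true) (points a b)

rowmotion : ∀ {a b} → Subset a b → Subset a b
rowmotion {a} {b} I p = any (λ m → isMinCompl I m ∧ (p ≤P m)) (points a b)

countDiag : ∀ {a b} → Subset a b → ℤ → ℕ
countDiag {a} {b} I k =
  sum (map (λ p → if I p ∧ diag p then 1 else 0) (points a b))
  where
  diag : Pt a b → Bool
  diag (i , j) = ⌊ (+ toℕ j) - (+ toℕ i) ℤ.≟ k ⌋

height : ∀ {a b} → Subset a b → ℤ → ℤ
height I k = + (∣ k ∣ ℕ.+ 2 ℕ.* countDiag I k)

-- sign-word: the i-th letter (1 ≤ i ≤ a+b) is h(i-a) - h(i-a-1)
signWord : (a b : ℕ) → Subset a b → List ℤ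
signWord a b I = map letter (upTo (a ℕ.+ b))
  where
  letter : ℕ → ℤ   -- n = i - 1
  letter n = height I ((+ suc n) - + a) - height I ((+ n) - + a)

-- The accumulator holds the current gap in reversed
-- order; a block is the factor -1 , +1 (found greedily from the left, which
-- is the unique non-overlapping decomposition).  Each gap is emitted
-- reversed and each block is emitted reversed as +1 , -1.
bgrGo : List ℤ → List ℤ → List ℤ
bgrGo acc (-[1+ zero ] ∷ + suc zero ∷ rest) = acc ++ (+ 1 ∷ -[1+ 0 ] ∷ bgrGo [] rest)
bgrGo acc (x ∷ rest) = bgrGo (x ∷ acc) rest
bgrGo acc [] = acc

blockGapReversal : List ℤ → List ℤ
blockGapReversal w = bgrGo [] w

module Submission where

-- Encode sign-words as Boolean words (true for +1) and compare corners:
--  * a word is determined by its length, number of trues and peaks (factors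
--    true , false, recorded with position and number of preceding trues);
--  * the peaks of the block-gap reversal bgr w are exactly the valleys
--    (factors false , true) of w, by induction over the gaps and blocks;
--  * the boundary profile S n of an order ideal I (the row where its
--    boundary crosses the n-th diagonal) yields the sign-word, letter n
--    being +1 iff S is flat at n; its peaks are the maximal elements of I,
--    its valleys the minimal elements of P \ I;
--  * the maximal elements of ΦI are the minimal elements of P \ I.
-- So the words of ΦI and of bgr (word of I) agree.

open import Defs

open import Data.Bool using (Bool; true; false; _∧_; not; if_then_else_; T)
open import Data.Bool.Properties using (not-¬; ¬-not; T-≡; ∧-zeroʳ; ∧-identityʳ)
open import Data.Empty using (⊥; ⊥-elim)
open import Data.Fin using (Fin; toℕ; fromℕ<)
open import Data.Fin.Properties using (toℕ<n; fromℕ<-toℕ; toℕ-fromℕ<; fromℕ<-cong)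
open import Data.Integer as ℤ using (ℤ; ∣_∣)
open import Data.Integer.Properties using ([+m]-[+n]≡m⊖n; ⊖-≥; ⊖-<; ∣⊖∣-<; +-injective)
import Data.Integer.Solver as ℤSolver
open import Data.List using (List; []; _∷_; _++_; map; length; applyUpTo; upTo; replicate; allFin; concatMap; tabulate)
open import Data.List.Properties
  using (length-applyUpTo; map-tabulate; map-applyUpTo; map-cong; map-∘; map-++; length-++; ++-assoc; ++-identityʳ)
open import Data.List.Membership.Propositional using (_∈_)
open import Data.List.Membership.Propositional.Properties using (∈-allFin; ∈-map⁺; ∈-concatMap⁺)
import Data.List.Relation.Unary.All as All
open import Data.List.Relation.Unary.All.Properties using (all⁺; all⁻)
import Data.List.Relation.Unary.Any as Any
open import Data.List.Relation.Unary.Any using (satisfied)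
open import Data.List.Relation.Unary.Any.Properties using (any⁺; any⁻)
open import Data.Nat using (ℕ; zero; suc; _+_; _*_; _∸_; _≤_; _<_; z≤n; s≤s; _<ᵇ_; _≡ᵇ_; _≤ᵇ_; _≥_; _≟_; _<?_; _≤?_)
open import Data.Nat.ListAction using (sum)
open import Data.Nat.ListAction.Properties using (sum-++)
open import Data.Nat.Properties
open import Data.Nat.Solver using (module +-*-Solver)
open import Data.Product using (Σ; _×_; _,_; proj₁; proj₂)
open import Data.Sum using (_⊎_; inj₁; inj₂)
open import Function using (_∘_)
open import Function.Bundles using (Equivalence)
open import Relation.Binary.PropositionalEquality
  using (_≡_; _≢_; refl; sym; trans; cong; cong₂; subst; subst₂; module ≡-Reasoning)
open import Relation.Nullary using (¬_; yes; no; Dec)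
open import Relation.Nullary.Decidable using (⌊_⌋)

true-false : ∀ {x} → x ≡ true → x ≡ false → ⊥
true-false refl ()

T⇒true : ∀ {x} → T x → x ≡ true
T⇒true = Equivalence.to T-≡

true⇒T : ∀ {x} → x ≡ true → T x
true⇒T = Equivalence.from T-≡

∧-true : ∀ {x y} → x ∧ y ≡ true → (x ≡ true) × (y ≡ true)
∧-true {true} {true} _ = refl , refl

<ᵇ-true : ∀ k c → k < c → (k <ᵇ c) ≡ true
<ᵇ-true k c k<c = T⇒true (<⇒<ᵇ k<c)

<ᵇ-false : ∀ k c → c ≤ k → (k <ᵇ c) ≡ false
<ᵇ-false k c c≤k = ¬-not (λ k<ᵇc → <⇒≱ (<ᵇ⇒< k c (true⇒T k<ᵇc)) c≤k)

+-left-comm : ∀ a b c → a + (b + c) ≡ b + (a + c)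
+-left-comm a b c = trans (sym (+-assoc a b c)) (trans (cong (_+ c) (+-comm a b)) (+-assoc b a c))

≤-by-< : ∀ {x y} → (∀ k → k < x → k < y) → x ≤ y
≤-by-< {zero} _ = z≤n
≤-by-< {suc x} below = below x ≤-refl

ind : Bool → ℕ
ind b = if b then 1 else 0

trues : List Bool → ℕ
trues [] = 0
trues (x ∷ xs) = ind x + trues xs

trues-++ : ∀ xs ys → trues (xs ++ ys) ≡ trues xs + trues ys
trues-++ [] ys = refl
trues-++ (x ∷ xs) ys = trans (cong (ind x +_) (trues-++ xs ys)) (sym (+-assoc (ind x) _ _))

trues≤length : ∀ xs → trues xs ≤ length xs
trues≤length [] = z≤n
trues≤length (true ∷ xs) = s≤s (trues≤length xs)
trues≤length (false ∷ xs) = m≤n⇒m≤1+n (trues≤length xs)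

count : (ℕ → Bool) → ℕ → ℕ
count f m = trues (applyUpTo f m)

count-snoc : ∀ f m → count f (suc m) ≡ count f m + ind (f m)
count-snoc f zero = +-identityʳ (ind (f 0))
count-snoc f (suc m) = trans (cong (ind (f 0) +_) (count-snoc (f ∘ suc) m)) (sym (+-assoc (ind (f 0)) _ _))

count≤ : ∀ f m → count f m ≤ m
count≤ f m = subst (count f m ≤_) (length-applyUpTo f m) (trues≤length (applyUpTo f m))

count-mono : ∀ f {k k'} → k ≤ k' → count f k ≤ count f k'
count-mono f {zero} _ = z≤n
count-mono f {suc k} {suc k'} (s≤s k≤k') = +-monoʳ-≤ (ind (f 0)) (count-mono (f ∘ suc) k≤k')

count-initial : ∀ m f → (∀ i → f (suc i) ≡ true → f i ≡ true) → (∀ i → m ≤ i → f i ≡ false) →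
                ∀ i → (f i ≡ true → i < count f m) × (i < count f m → f i ≡ true)
count-initial zero f down vanish i = (λ fi → ⊥-elim (true-false fi (vanish i z≤n))) , λ ()
count-initial (suc m) f down vanish i with f 0 in f0
... | false = (λ fi → ⊥-elim (true-false (to-zero i fi) f0)) ,
              (λ i<c → ⊥-elim (true-false (down 0 (proj₂ (rest 0) (≤-<-trans z≤n i<c))) f0))
  where
  to-zero : ∀ i → f i ≡ true → f 0 ≡ true
  to-zero zero fi = fi
  to-zero (suc i) fi = to-zero i (down i fi)
  rest = count-initial m (f ∘ suc) (down ∘ suc) (λ i m≤i → vanish (suc i) (s≤s m≤i))
... | true with i
...   | zero = (λ _ → s≤s z≤n) , (λ _ → f0)
...   | suc i' = (λ fi → s≤s (proj₁ (rest i') fi)) , (λ i<c → proj₂ (rest i') (≤-pred i<c))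
  where
  rest = count-initial m (f ∘ suc) (down ∘ suc) (λ i m≤i → vanish (suc i) (s≤s m≤i))

count-true : ∀ f m → f m ≡ true → count f (suc m) ≡ suc (count f m)
count-true f m fm = trans (count-snoc f m) (trans (cong (λ z → count f m + ind z) fm) (+-comm (count f m) 1))

count-false : ∀ f m → f m ≡ false → count f (suc m) ≡ count f m
count-false f m fm = trans (count-snoc f m) (trans (cong (λ z → count f m + ind z) fm) (+-identityʳ _))

count-none : ∀ f m → (∀ j → f j ≡ false) → count f m ≡ 0
count-none f zero none = refl
count-none f (suc m) none rewrite none 0 = count-none (f ∘ suc) m (none ∘ suc)

count-only : ∀ f t m → (∀ j → j ≢ t → f j ≡ false) → (m ≤ t → f t ≡ false) → count f m ≡ ind (f t)
count-only f t zero only beyond = cong ind (sym (beyond z≤n))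
count-only f zero (suc m) only beyond =
  trans (cong (ind (f 0) +_) (count-none (f ∘ suc) m λ j → only (suc j) λ ())) (+-identityʳ _)
count-only f (suc t) (suc m) only beyond rewrite only 0 (λ ()) =
  count-only (f ∘ suc) t m (λ j j≢t → only (suc j) (j≢t ∘ suc-injective)) (beyond ∘ s≤s)

count-if : ∀ c u m → count (λ i → if c i then true else u i) m ≡
                     count c m + count (λ i → if c i then false else u i) m
count-if c u zero = refl
count-if c u (suc m) with c 0
... | true = cong suc (count-if (c ∘ suc) (u ∘ suc) m)
... | false = trans (cong (ind (u 0) +_) (count-if (c ∘ suc) (u ∘ suc) m))
                (+-left-comm (ind (u 0)) (count (c ∘ suc) m) _)

count-below : ∀ n c → count (λ i → i + n <ᵇ c) c ≡ c ∸ n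
count-below n zero = sym (0∸n≡0 n)
count-below n (suc c) = trans (cong (ind (n <ᵇ suc c) +_) (count-below n c)) (first-row (n ≤? c))
  where
  first-row : Dec (n ≤ c) → ind (n <ᵇ suc c) + (c ∸ n) ≡ suc c ∸ n
  first-row (yes n≤c) rewrite <ᵇ-true n (suc c) (s≤s n≤c) = sym (+-∸-assoc 1 n≤c)
  first-row (no n≰c) rewrite <ᵇ-false n (suc c) (≰⇒> n≰c) =
    trans (m≤n⇒m∸n≡0 (<⇒≤ (≰⇒> n≰c))) (sym (m≤n⇒m∸n≡0 (≰⇒> n≰c)))

-- Words and occurrences of two-letter factors.  A letter true stands for
-- a step +1 of the sign-word, a letter false for a step -1.

StartsWith : Bool → List Bool → Set
StartsWith y [] = ⊥
StartsWith y (z ∷ _) = z ≡ y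

starts-same : ∀ {x y} w → StartsWith x w → StartsWith y w → x ≡ y
starts-same (z ∷ _) refl refl = refl

-- Occ x y w m v: the factor x , y occurs in w at position m, and the m
-- letters before it contain exactly v letters true.
Occ : Bool → Bool → List Bool → ℕ → ℕ → Set
Occ x y [] m v = ⊥
Occ x y (z ∷ w) zero zero = (z ≡ x) × StartsWith y w
Occ x y (z ∷ w) zero (suc v) = ⊥
Occ x y (true ∷ w) (suc m) zero = ⊥
Occ x y (true ∷ w) (suc m) (suc v) = Occ x y w m v
Occ x y (false ∷ w) (suc m) v = Occ x y w m v

Peak Valley : List Bool → ℕ → ℕ → Set
Peak = Occ true false
Valley = Occ false true

occ-cons : ∀ {x y} z w m v → Occ x y w m v → Occ x y (z ∷ w) (suc m) (ind z + v)
occ-cons true w m v o = o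
occ-cons false w m v o = o

occ-uncons : ∀ {x y} z w m v → Occ x y (z ∷ w) (suc m) v →
             Σ ℕ λ v' → (v ≡ ind z + v') × Occ x y w m v'
occ-uncons true w m (suc v) o = v , refl , o
occ-uncons false w m v o = v , refl , o

occ-v≤m : ∀ {x y} w m v → Occ x y w m v → v ≤ m
occ-v≤m (z ∷ w) zero zero o = z≤n
occ-v≤m (z ∷ w) (suc m) v o with occ-uncons z w m v o
... | v' , refl , o' with z
...   | true = s≤s (occ-v≤m w m v' o')
...   | false = m≤n⇒m≤1+n (occ-v≤m w m v' o')

initial-run : ∀ w → (trues w ≡ length w) ⊎ (Σ ℕ λ m → Peak (true ∷ w) m m)
initial-run [] = inj₁ refl
initial-run (false ∷ w) = inj₂ (0 , refl , refl)
initial-run (true ∷ w) with initial-run w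
... | inj₁ e = inj₁ (cong suc e)
... | inj₂ (m , o) = inj₂ (suc m , o)

first-letter-differs : ∀ w w' → length w ≡ length w' → suc (trues w) ≡ trues w' →
                       (∀ m v → Peak (true ∷ w) m v → Peak (false ∷ w') m v) → ⊥
first-letter-differs w w' len tr peaks with initial-run w
... | inj₁ all-true = 1+n≰n (begin
  suc (length w')   ≡⟨ cong suc (sym len) ⟩
  suc (length w)    ≡⟨ cong suc (sym all-true) ⟩
  suc (trues w)     ≡⟨ tr ⟩
  trues w'          ≤⟨ trues≤length w' ⟩
  length w'         ∎)
  where open ≤-Reasoning
... | inj₂ (zero , o) with () ← proj₁ (peaks zero zero o)
... | inj₂ (suc m , o) = 1+n≰n (occ-v≤m w' m (suc m) (peaks (suc m) (suc m) o))

peaks-determine : ∀ w w' → length w ≡ length w' → trues w ≡ trues w' →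
                  (∀ m v → Peak w m v → Peak w' m v) →
                  (∀ m v → Peak w' m v → Peak w m v) → w ≡ w'
peaks-determine [] [] _ _ _ _ = refl
peaks-determine (true ∷ w) (true ∷ w') len tr to from =
  cong (true ∷_) (peaks-determine w w' (suc-injective len) (suc-injective tr)
    (λ m v → to (suc m) (suc v)) (λ m v → from (suc m) (suc v)))
peaks-determine (false ∷ w) (false ∷ w') len tr to from =
  cong (false ∷_) (peaks-determine w w' (suc-injective len) tr
    (λ m v → to (suc m) v) (λ m v → from (suc m) v))
peaks-determine (true ∷ w) (false ∷ w') len tr to from =
  ⊥-elim (first-letter-differs w w' (suc-injective len) tr to)
peaks-determine (false ∷ w) (true ∷ w') len tr to from =
  ⊥-elim (first-letter-differs w' w (suc-injective (sym len)) (sym tr) from)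

occ-tabulated→ : ∀ {x y} N g m v → Occ x y (applyUpTo g N) m v →
                 (suc (suc m) ≤ N) × (g m ≡ x) × (g (suc m) ≡ y) × (count g m ≡ v)
occ-tabulated→ (suc zero) g zero zero (_ , ())
occ-tabulated→ (suc (suc N)) g zero zero (e₁ , e₂) = s≤s (s≤s z≤n) , e₁ , e₂ , refl
occ-tabulated→ (suc N) g (suc m) v o with occ-uncons (g 0) _ m v o
... | v' , refl , o' with occ-tabulated→ N (g ∘ suc) m v' o'
... | bound , e₁ , e₂ , e₃ = s≤s bound , e₁ , e₂ , cong (ind (g 0) +_) e₃

occ-tabulated← : ∀ {x y} N g m → suc (suc m) ≤ N → g m ≡ x → g (suc m) ≡ y →
                 Occ x y (applyUpTo g N) m (count g m)
occ-tabulated← (suc (suc N)) g zero _ e₁ e₂ = e₁ , e₂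
occ-tabulated← (suc N) g (suc m) (s≤s bound) e₁ e₂ =
  occ-cons (g 0) _ m _ (occ-tabulated← N (g ∘ suc) m bound e₁ e₂)

bgrAcc : List Bool → List Bool → List Bool
bgrAcc acc (false ∷ true ∷ rest) = acc ++ (true ∷ false ∷ bgrAcc [] rest)
bgrAcc acc (x ∷ rest) = bgrAcc (x ∷ acc) rest
bgrAcc acc [] = acc

bgr : List Bool → List Bool
bgr = bgrAcc []

toZ : Bool → ℤ
toZ true = ℤ.+ 1
toZ false = ℤ.-[1+ 0 ]

toZ-bgrAcc : ∀ acc w → map toZ (bgrAcc acc w) ≡ bgrGo (map toZ acc) (map toZ w)
toZ-bgrAcc acc [] = refl
toZ-bgrAcc acc (false ∷ true ∷ r) =
  trans (map-++ toZ acc _) (cong (λ z → map toZ acc ++ (ℤ.+ 1 ∷ ℤ.-[1+ 0 ] ∷ z)) (toZ-bgrAcc [] r))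
toZ-bgrAcc acc (false ∷ false ∷ r) = toZ-bgrAcc (false ∷ acc) (false ∷ r)
toZ-bgrAcc acc (false ∷ []) = refl
toZ-bgrAcc acc (true ∷ r) = toZ-bgrAcc (true ∷ acc) r

-- bgr only permutes letters, so it preserves length and number of trues
length-bgrAcc : ∀ acc w → length (bgrAcc acc w) ≡ length acc + length w
length-bgrAcc acc [] = sym (+-identityʳ _)
length-bgrAcc acc (false ∷ true ∷ r) =
  trans (length-++ acc) (cong (λ z → length acc + suc (suc z)) (length-bgrAcc [] r))
length-bgrAcc acc (false ∷ false ∷ r) = trans (length-bgrAcc (false ∷ acc) (false ∷ r)) (sym (+-suc _ _))
length-bgrAcc acc (false ∷ []) = trans (sym (+-identityʳ _)) (sym (+-suc _ _))
length-bgrAcc acc (true ∷ r) = trans (length-bgrAcc (true ∷ acc) r) (sym (+-suc _ _))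

trues-bgrAcc : ∀ acc w → trues (bgrAcc acc w) ≡ trues acc + trues w
trues-bgrAcc acc [] = sym (+-identityʳ _)
trues-bgrAcc acc (false ∷ true ∷ r) =
  trans (trues-++ acc _) (cong (λ z → trues acc + suc z) (trues-bgrAcc [] r))
trues-bgrAcc acc (false ∷ false ∷ r) = trues-bgrAcc (false ∷ acc) (false ∷ r)
trues-bgrAcc acc (false ∷ []) = sym (+-identityʳ _)
trues-bgrAcc acc (true ∷ r) = trans (trues-bgrAcc (true ∷ acc) r) (sym (+-suc _ _))

data Blocks : List Bool → Set where
  gap   : ∀ p q → Blocks (replicate p true ++ replicate q false)
  block : ∀ p q {r} → Blocks r →
          Blocks (replicate p true ++ replicate q false ++ false ∷ true ∷ r)

blocks : ∀ w → Blocks w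
blocks [] = gap 0 0
blocks (true ∷ w) with blocks w
... | gap p q = gap (suc p) q
... | block p q b = block (suc p) q b
blocks (false ∷ w) with blocks w
... | gap zero q = gap zero (suc q)
... | gap (suc p) q = block 0 0 (gap p q)
... | block zero q b = block zero (suc q) b
... | block (suc p) q b = block 0 0 (block p q b)

run-swap : ∀ (x : Bool) p ys → replicate p x ++ x ∷ ys ≡ x ∷ replicate p x ++ ys
run-swap x zero ys = refl
run-swap x (suc p) ys = cong (x ∷_) (run-swap x p ys)

push-trues : ∀ acc p X → bgrAcc acc (replicate p true ++ X) ≡ bgrAcc (replicate p true ++ acc) X
push-trues acc zero X = refl
push-trues acc (suc p) X =
  trans (push-trues (true ∷ acc) p X) (cong (λ z → bgrAcc z X) (run-swap true p acc))

push-false : ∀ acc Y → ¬ StartsWith true Y → bgrAcc acc (false ∷ Y) ≡ bgrAcc (false ∷ acc) Y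
push-false acc [] _ = refl
push-false acc (false ∷ Y) _ = refl
push-false acc (true ∷ Y) notBlock = ⊥-elim (notBlock refl)

push-falses : ∀ acc q X → ¬ StartsWith true X →
              bgrAcc acc (replicate q false ++ X) ≡ bgrAcc (replicate q false ++ acc) X
push-falses acc zero X notBlock = refl
push-falses acc (suc q) X notBlock =
  trans (push-false acc _ (no-block q))
    (trans (push-falses (false ∷ acc) q X notBlock) (cong (λ z → bgrAcc z X) (run-swap false q acc)))
  where
  no-block : ∀ q → ¬ StartsWith true (replicate q false ++ X)
  no-block zero = notBlock
  no-block (suc q) ()

bgr-gap : ∀ p q → bgr (replicate p true ++ replicate q false) ≡ replicate q false ++ replicate p true
bgr-gap p q = begin
  bgrAcc [] (replicate p true ++ replicate q false)
    ≡⟨ push-trues [] p (replicate q false) ⟩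
  bgrAcc (replicate p true ++ []) (replicate q false)
    ≡⟨ cong (bgrAcc _) (sym (++-identityʳ (replicate q false))) ⟩
  bgrAcc (replicate p true ++ []) (replicate q false ++ [])
    ≡⟨ push-falses (replicate p true ++ []) q [] (λ ()) ⟩
  replicate q false ++ replicate p true ++ []
    ≡⟨ cong (replicate q false ++_) (++-identityʳ _) ⟩
  replicate q false ++ replicate p true ∎
  where open ≡-Reasoning

bgr-block : ∀ p q r → bgr (replicate p true ++ replicate q false ++ false ∷ true ∷ r)
          ≡ replicate q false ++ replicate p true ++ true ∷ false ∷ bgr r
bgr-block p q r = begin
  bgrAcc [] (replicate p true ++ replicate q false ++ false ∷ true ∷ r)
    ≡⟨ push-trues [] p _ ⟩
  bgrAcc (replicate p true ++ []) (replicate q false ++ false ∷ true ∷ r)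
    ≡⟨ cong (λ z → bgrAcc z (replicate q false ++ false ∷ true ∷ r)) (++-identityʳ _) ⟩
  bgrAcc (replicate p true) (replicate q false ++ false ∷ true ∷ r)
    ≡⟨ push-falses (replicate p true) q (false ∷ true ∷ r) (λ ()) ⟩
  (replicate q false ++ replicate p true) ++ true ∷ false ∷ bgr r
    ≡⟨ ++-assoc (replicate q false) (replicate p true) _ ⟩
  replicate q false ++ replicate p true ++ true ∷ false ∷ bgr r ∎
  where open ≡-Reasoning

occ-shift : ∀ {x y} u w m v → Occ x y w m v → Occ x y (u ++ w) (length u + m) (trues u + v)
occ-shift [] w m v o = o
occ-shift (z ∷ u) w m v o =
  subst (Occ _ _ (z ∷ u ++ w) (suc (length u + m))) (sym (+-assoc (ind z) (trues u) v))
    (occ-cons z (u ++ w) _ _ (occ-shift u w m v o))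

occ-skip : ∀ x {y} q Y m v → Occ x y (replicate q (not x) ++ Y) m v →
           Σ ℕ λ m' → Σ ℕ λ v' → (m ≡ length (replicate q (not x)) + m') ×
             (v ≡ trues (replicate q (not x)) + v') × Occ x y Y m' v'
occ-skip x zero Y m v o = m , v , refl , refl , o
occ-skip x (suc q) Y zero zero (e , _) = ⊥-elim (not-¬ refl (sym e))
occ-skip x (suc q) Y (suc m) v o with occ-uncons (not x) _ m v o
... | v₁ , refl , o₁ with occ-skip x q Y m v₁ o₁
... | m' , v' , refl , refl , o' = m' , v' , refl , sym (+-assoc (ind (not x)) _ v') , o'

no-occ-in-run : ∀ x p m v → Occ x (not x) (replicate p x) m v → ⊥
no-occ-in-run x (suc zero) zero zero (_ , ())
no-occ-in-run x (suc (suc p)) zero zero (_ , e) = not-¬ refl e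
no-occ-in-run x (suc p) (suc m) v o with occ-uncons x _ m v o
... | v' , _ , o' = no-occ-in-run x p m v' o'

occ-skip-into : ∀ x p Y m v → StartsWith x Y → Occ x (not x) (replicate p x ++ Y) m v →
                Σ ℕ λ m' → Σ ℕ λ v' → (m ≡ length (replicate p x) + m') ×
                  (v ≡ trues (replicate p x) + v') × Occ x (not x) Y m' v'
occ-skip-into x zero Y m v _ o = m , v , refl , refl , o
occ-skip-into x (suc p) Y zero zero startsX (_ , e) = ⊥-elim (not-¬ refl (run-starts p e))
  where
  run-starts : ∀ p → StartsWith (not x) (replicate p x ++ Y) → x ≡ not x
  run-starts zero e = starts-same Y startsX e
  run-starts (suc p) e = e
occ-skip-into x (suc p) Y (suc m) v startsX o with occ-uncons x _ m v o
... | v₁ , refl , o₁ with occ-skip-into x p Y m v₁ startsX o₁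
... | m' , v' , refl , refl , o' = m' , v' , refl , sym (+-assoc (ind x) _ v') , o'

block-to : ∀ u u' → (∀ m v → Peak u' m v → Valley u m v) →
           ∀ m v → Peak (true ∷ false ∷ u') m v → Valley (false ∷ true ∷ u) m v
block-to u u' h zero zero _ = refl , refl
block-to u u' h (suc zero) (suc zero) (() , _)
block-to u u' h (suc (suc m)) (suc v) o = h m v o

block-from : ∀ u u' → (∀ m v → Valley u m v → Peak u' m v) →
             ∀ m v → Valley (false ∷ true ∷ u) m v → Peak (true ∷ false ∷ u') m v
block-from u u' h zero zero _ = refl , refl
block-from u u' h (suc zero) zero (() , _)
block-from u u' h (suc (suc m)) (suc v) o = h m v o

-- By induction along the decomposition into gaps and
-- blocks: a gap contributes neither, and every block false , true of w
-- becomes a peak true , false at the same position of bgr w.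
PeaksOfBgr : List Bool → Set
PeaksOfBgr w = (∀ m v → Peak (bgr w) m v → Valley w m v) × (∀ m v → Valley w m v → Peak (bgr w) m v)

peaks-of-bgr : ∀ {w} → Blocks w → PeaksOfBgr w
peaks-of-bgr (gap p q) = to , from
  where
  G = replicate p true ++ replicate q false
  to : ∀ m v → Peak (bgr G) m v → Valley G m v
  to m v o with occ-skip true q (replicate p true) m v (subst (λ w → Peak w m v) (bgr-gap p q) o)
  ... | m' , v' , _ , _ , o' = ⊥-elim (no-occ-in-run true p m' v' o')
  from : ∀ m v → Valley G m v → Peak (bgr G) m v
  from m v o with occ-skip false p (replicate q false) m v o
  ... | m' , v' , _ , _ , o' = ⊥-elim (no-occ-in-run false q m' v' o')
peaks-of-bgr (block p q {r} b) = to , from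
  where
  Tp = replicate p true
  Fq = replicate q false
  W = Tp ++ Fq ++ false ∷ true ∷ r
  ih = peaks-of-bgr b
  to : ∀ m v → Peak (bgr W) m v → Valley W m v
  to m v o with occ-skip true q _ m v (subst (λ w → Peak w m v) (bgr-block p q r) o)
  ... | m₁ , v₁ , refl , refl , o₁ with occ-skip-into true p _ m₁ v₁ refl o₁
  ... | m₂ , v₂ , refl , refl , o₂ =
    subst₂ (Valley W) (+-left-comm (length Tp) (length Fq) m₂) (+-left-comm (trues Tp) (trues Fq) v₂)
      (occ-shift Tp _ _ _ (occ-shift Fq _ m₂ v₂ (block-to r (bgr r) (proj₁ ih) m₂ v₂ o₂)))
  from : ∀ m v → Valley W m v → Peak (bgr W) m v
  from m v o with occ-skip false p _ m v o
  ... | m₁ , v₁ , refl , refl , o₁ with occ-skip-into false q _ m₁ v₁ refl o₁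
  ... | m₂ , v₂ , refl , refl , o₂ =
    subst (λ w → Peak w _ _) (sym (bgr-block p q r))
      (subst₂ (Peak (Fq ++ Tp ++ true ∷ false ∷ bgr r))
        (+-left-comm (length Fq) (length Tp) m₂) (+-left-comm (trues Fq) (trues Tp) v₂)
        (occ-shift Fq _ _ _ (occ-shift Tp _ m₂ v₂ (block-from r (bgr r) (proj₂ ih) m₂ v₂ o₂))))

DownClosed : (ℕ → ℕ → Bool) → Set
DownClosed Î = ∀ i j i' j' → i ≤ i' → j ≤ j' → Î i' j' ≡ true → Î i j ≡ true

-- Î is contained in [a] × [b] (coordinates counted from 0)
Within : ℕ → ℕ → (ℕ → ℕ → Bool) → Set
Within a b Î = ∀ i j → Î i j ≡ true → (i < a) × (j < b)

Maximal : (ℕ → ℕ → Bool) → ℕ → ℕ → Set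
Maximal Î i j = (Î i j ≡ true) × (Î (suc i) j ≡ false) × (Î i (suc j) ≡ false)

MinimalOutside : ℕ → ℕ → (ℕ → ℕ → Bool) → ℕ → ℕ → Set
MinimalOutside a b Î i j =
  (i < a) × (j < b) × (Î i j ≡ false) ×
  (∀ i' j' → i' ≤ i → j' ≤ j → ¬ ((i' ≡ i) × (j' ≡ j)) → Î i' j' ≡ true)

LowerNeighboursIn : (ℕ → ℕ → Bool) → ℕ → ℕ → Set
LowerNeighboursIn Î i j = (∀ k → i ≡ suc k → Î k j ≡ true) × (∀ l → j ≡ suc l → Î i l ≡ true)

minimal⇒lower : ∀ {a b} Î i j → MinimalOutside a b Î i j → LowerNeighboursIn Î i j
minimal⇒lower Î i j (_ , _ , _ , below) =
  (λ { k refl → below k j (n≤1+n k) ≤-refl (λ (k≡ , _) → 1+n≢n (sym k≡)) }) ,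
  (λ { l refl → below i l ≤-refl (n≤1+n l) (λ (_ , l≡) → 1+n≢n (sym l≡)) })

below-corner : ∀ Î → DownClosed Î → ∀ i j → LowerNeighboursIn Î i j →
               ∀ i' j' → i' ≤ i → j' ≤ j → ¬ ((i' ≡ i) × (j' ≡ j)) → Î i' j' ≡ true
below-corner Î down i j (left , under) i' j' i'≤i j'≤j i'j'≢ij with i' ≟ i
... | no i'≢i with i | ≤∧≢⇒< i'≤i i'≢i
...   | suc k | s≤s i'≤k = down i' j' k j i'≤k j'≤j (left k refl)
below-corner Î down i j (left , under) i' j' i'≤i j'≤j i'j'≢ij | yes i'≡i
  with j | ≤∧≢⇒< j'≤j (λ j'≡j → i'j'≢ij (i'≡i , j'≡j))
... | suc l | s≤s j'≤l = down i' j' i l i'≤i j'≤l (under l refl)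

-- The
-- diagonal j - i = n - a (n = 0 … a + b) meets Î, together with the cells
-- of negative column, in an initial segment of rows of length S n.  The
-- profile S falls from a to 0 in steps 0 or 1; its word of steps (true for
-- a step 0) is the sign-word of Î, and its peaks and valleys are the
-- maximal elements of Î and the minimal elements of its complement.
module Profile (a b : ℕ) (Î : ℕ → ℕ → Bool) (down : DownClosed Î) (within : Within a b Î) where

  -- row i of the n-th diagonal, i.e. the cell (i , i + n - a), is inside
  Inside : ℕ → ℕ → Bool
  Inside n i = if i + n <ᵇ a then true else Î i (i + n ∸ a)

  S : ℕ → ℕ
  S n = count (Inside n) a

  inside-below : ∀ n i → i + n < a → Inside n i ≡ true
  inside-below n i lt rewrite <ᵇ-true (i + n) a lt = refl

  inside-cell : ∀ n i j → i + n ≡ a + j → Inside n i ≡ Î i j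
  inside-cell n i j diag rewrite <ᵇ-false (i + n) a (subst (a ≤_) (sym diag) (m≤m+n a j)) =
    cong (Î i) (trans (cong (_∸ a) diag) (m+n∸m≡n a j))

  inside-down : ∀ n i n' i' → i' ≤ i → i' + n' ≤ i + n → Inside n i ≡ true → Inside n' i' ≡ true
  inside-down n i n' i' i'≤i diag≤ ins with i' + n' <? a
  ... | yes lt = inside-below n' i' lt
  ... | no ¬lt = trans (inside-cell n' i' _ (sym (m+[n∸m]≡n a≤)))
                   (down i' _ i _ i'≤i (∸-monoˡ-≤ a diag≤)
                     (trans (sym (inside-cell n i _ (sym (m+[n∸m]≡n (≤-trans a≤ diag≤))))) ins))
    where
    a≤ : a ≤ i' + n'
    a≤ = ≮⇒≥ ¬lt

  outside-rows : ∀ n i → a ≤ i → Inside n i ≡ false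
  outside-rows n i a≤i = ¬-not λ ins →
    <⇒≱ (proj₁ (within i _ (trans (sym (inside-cell n i _ (sym (m+[n∸m]≡n a≤)))) ins))) a≤i
    where
    a≤ : a ≤ i + n
    a≤ = ≤-trans a≤i (m≤m+n i n)

  inside⇔ : ∀ n i → (Inside n i ≡ true → i < S n) × (i < S n → Inside n i ≡ true)
  inside⇔ n = count-initial a (Inside n) (λ i → inside-down n (suc i) n i (n≤1+n i) (n≤1+n (i + n))) (outside-rows n)

  ∈⇒<S : ∀ n i j → i + n ≡ a + j → Î i j ≡ true → i < S n
  ∈⇒<S n i j diag ij∈ = proj₁ (inside⇔ n i) (trans (inside-cell n i j diag) ij∈)

  <S⇒∈ : ∀ n i j → i + n ≡ a + j → i < S n → Î i j ≡ true
  <S⇒∈ n i j diag i<S = trans (sym (inside-cell n i j diag)) (proj₂ (inside⇔ n i) i<S)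

  ∉⇒S≤ : ∀ n i j → i + n ≡ a + j → Î i j ≡ false → S n ≤ i
  ∉⇒S≤ n i j diag ij∉ = ≮⇒≥ (λ i<S → true-false (<S⇒∈ n i j diag i<S) ij∉)

  S≤⇒∉ : ∀ n i j → i + n ≡ a + j → S n ≤ i → Î i j ≡ false
  S≤⇒∉ n i j diag S≤i = ¬-not (λ ij∈ → <⇒≱ (∈⇒<S n i j diag ij∈) S≤i)

  below⇒<S : ∀ n i → i + n < a → i < S n
  below⇒<S n i lt = proj₁ (inside⇔ n i) (inside-below n i lt)

  S≤a : ∀ n → S n ≤ a
  S≤a n = count≤ (Inside n) a

  S-mono : ∀ n → S (suc n) ≤ S n
  S-mono n = ≤-by-< λ k k<S → proj₁ (inside⇔ n k)
    (inside-down (suc n) k n k ≤-refl (+-monoʳ-≤ k (n≤1+n n)) (proj₂ (inside⇔ (suc n) k) k<S))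

  S-step : ∀ n → S n ≤ suc (S (suc n))
  S-step n = ≤-by-< shift
    where
    shift : ∀ k → k < S n → k < suc (S (suc n))
    shift zero _ = s≤s z≤n
    shift (suc k) k<S = s≤s (proj₁ (inside⇔ (suc n) k)
      (inside-down n (suc k) (suc n) k (n≤1+n k) (≤-reflexive (+-suc k n)) (proj₂ (inside⇔ n (suc k)) k<S)))

  S-start : S 0 ≡ a
  S-start = ≤-antisym (S≤a 0) (≤-by-< λ k k<a → below⇒<S 0 k (subst (_< a) (sym (+-identityʳ k)) k<a))

  S-end : S (a + b) ≡ 0
  S-end = n≤0⇒n≡0 (≤-by-< λ k k<S →
    ⊥-elim (m+n≮n k b (proj₂ (within k (k + b) (<S⇒∈ (a + b) k (k + b) (+-left-comm k a b) k<S)))))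

  OnDiagonal : ℕ → ℕ → Bool
  OnDiagonal n i = if i + n <ᵇ a then false else Î i (i + n ∸ a)

  S-split : ∀ n → S n ≡ (a ∸ n) + count (OnDiagonal n) a
  S-split n = trans (count-if (λ i → i + n <ᵇ a) (λ i → Î i (i + n ∸ a)) a) (cong (_+ count (OnDiagonal n) a) (count-below n a))

  row-on-diagonal : ∀ n i → count (λ j → Î i j ∧ (i + n ≡ᵇ a + j)) b ≡ ind (OnDiagonal n i)
  row-on-diagonal n i with i + n <? a
  ... | yes lt rewrite <ᵇ-true (i + n) a lt =
    count-none _ b λ j → trans (cong (Î i j ∧_) (¬-not λ e → <⇒≱ lt (subst (a ≤_) (sym (≡ᵇ⇒≡ _ _ (true⇒T e))) (m≤m+n a j))))
                               (∧-zeroʳ (Î i j))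
  ... | no ¬lt rewrite <ᵇ-false (i + n) a (≮⇒≥ ¬lt) =
    trans (count-only _ t b only beyond) (cong ind (trans (cong (Î i t ∧_) on-t) (∧-identityʳ (Î i t))))
    where
    t = i + n ∸ a
    diag-t : i + n ≡ a + t
    diag-t = sym (m+[n∸m]≡n (≮⇒≥ ¬lt))
    on-t : (i + n ≡ᵇ a + t) ≡ true
    on-t = T⇒true (≡⇒≡ᵇ _ _ diag-t)
    only : ∀ j → j ≢ t → (Î i j ∧ (i + n ≡ᵇ a + j)) ≡ false
    only j j≢t = trans (cong (Î i j ∧_) (¬-not λ e → j≢t (+-cancelˡ-≡ a _ _ (trans (sym (≡ᵇ⇒≡ _ _ (true⇒T e))) diag-t))))
                   (∧-zeroʳ (Î i j))
    beyond : b ≤ t → (Î i t ∧ (i + n ≡ᵇ a + t)) ≡ false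
    beyond b≤t rewrite ¬-not {Î i t} (λ e → <⇒≱ (proj₂ (within i t e)) b≤t) = refl

  letter : ℕ → Bool
  letter n = S (suc n) ≡ᵇ S n

  flat⇒letter : ∀ n → S (suc n) ≡ S n → letter n ≡ true
  flat⇒letter n flat = T⇒true (≡⇒≡ᵇ _ _ flat)

  drop⇒letter : ∀ n → suc (S (suc n)) ≡ S n → letter n ≡ false
  drop⇒letter n drop = ¬-not λ e → 1+n≢n (trans drop (sym (≡ᵇ⇒≡ _ _ (true⇒T e))))

  letter⇒flat : ∀ n → letter n ≡ true → S (suc n) ≡ S n
  letter⇒flat n e = ≡ᵇ⇒≡ _ _ (true⇒T e)

  letter⇒drop : ∀ n → letter n ≡ false → suc (S (suc n)) ≡ S n
  letter⇒drop n e = ≤-antisym (≤∧≢⇒< (S-mono n) λ flat → true-false (flat⇒letter n flat) e) (S-step n)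

  word : List Bool
  word = applyUpTo letter (a + b)

  trues-prefix : ∀ m → count letter m + a ≡ m + S m
  trues-prefix zero = sym S-start
  trues-prefix (suc m) with letter m in e
  ... | true = begin
    count letter (suc m) + a  ≡⟨ cong (_+ a) (count-true letter m e) ⟩
    suc (count letter m + a)  ≡⟨ cong suc (trues-prefix m) ⟩
    suc (m + S m)             ≡⟨ cong (λ s → suc (m + s)) (sym (letter⇒flat m e)) ⟩
    suc m + S (suc m)         ∎
    where open ≡-Reasoning
  ... | false = begin
    count letter (suc m) + a  ≡⟨ cong (_+ a) (count-false letter m e) ⟩
    count letter m + a        ≡⟨ trues-prefix m ⟩
    m + S m                   ≡⟨ cong (m +_) (sym (letter⇒drop m e)) ⟩
    m + suc (S (suc m))       ≡⟨ +-suc m _ ⟩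
    suc m + S (suc m)         ∎
    where open ≡-Reasoning

  word-length : length word ≡ a + b
  word-length = length-applyUpTo letter (a + b)

  word-trues : trues word ≡ b
  word-trues = +-cancelˡ-≡ a _ _ (begin
    a + count letter (a + b)  ≡⟨ +-comm a _ ⟩
    count letter (a + b) + a  ≡⟨ trues-prefix (a + b) ⟩
    a + b + S (a + b)         ≡⟨ cong (a + b +_) S-end ⟩
    a + b + 0                 ≡⟨ +-identityʳ _ ⟩
    a + b                     ∎)
    where open ≡-Reasoning

  corner-position : ∀ m v i → count letter m ≡ v → S m ≡ suc i → i + suc m ≡ a + v
  corner-position m v i c S≡ = begin
    i + suc m        ≡⟨ +-comm i (suc m) ⟩
    suc m + i        ≡⟨ sym (+-suc m i) ⟩
    m + suc i        ≡⟨ cong (m +_) (sym S≡) ⟩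
    m + S m          ≡⟨ sym (trues-prefix m) ⟩
    count letter m + a ≡⟨ cong (_+ a) c ⟩
    v + a            ≡⟨ +-comm v a ⟩
    a + v            ∎
    where open ≡-Reasoning

  corner-count : ∀ m v i → i + suc m ≡ a + v → S m ≡ suc i → count letter m ≡ v
  corner-count m v i diag S≡ = +-cancelʳ-≡ _ _ _ (begin
    count letter m + a ≡⟨ trues-prefix m ⟩
    m + S m          ≡⟨ cong (m +_) S≡ ⟩
    m + suc i        ≡⟨ +-suc m i ⟩
    suc m + i        ≡⟨ +-comm (suc m) i ⟩
    i + suc m        ≡⟨ diag ⟩
    a + v            ≡⟨ +-comm a v ⟩
    v + a            ∎)
    where open ≡-Reasoning

  corner-in-range : ∀ m v i → i + suc m ≡ a + v → v < b → suc (suc m) ≤ a + b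
  corner-in-range m v i diag v<b = begin
    suc (suc m)       ≤⟨ s≤s (m≤n+m (suc m) i) ⟩
    suc (i + suc m)   ≡⟨ cong suc diag ⟩
    suc (a + v)       ≡⟨ sym (+-suc a v) ⟩
    a + suc v         ≤⟨ +-monoʳ-≤ a v<b ⟩
    a + b             ∎
    where open ≤-Reasoning

  -- Peaks of the word are the maximal elements of Î: a peak at m after v
  -- trues is the corner (S (m + 2) , v) of the diagonal m + 1.
  peak⇒maximal : ∀ m v → Peak word m v → Σ ℕ λ i → (i + suc m ≡ a + v) × Maximal Î i v
  peak⇒maximal m v o with occ-tabulated→ (a + b) letter m v o
  ... | _ , plus , minus , c = i , diag , in-Î , right-out , above-out
    where
    i = S (suc (suc m))
    drop : suc i ≡ S (suc m)
    drop = letter⇒drop (suc m) minus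
    S≡ : S m ≡ suc i
    S≡ = trans (sym (letter⇒flat m plus)) (sym drop)
    diag : i + suc m ≡ a + v
    diag = corner-position m v i c S≡
    in-Î : Î i v ≡ true
    in-Î = <S⇒∈ (suc m) i v diag (≤-reflexive drop)
    right-out : Î (suc i) v ≡ false
    right-out = S≤⇒∉ m (suc i) v (trans (sym (+-suc i m)) diag) (≤-reflexive S≡)
    above-out : Î i (suc v) ≡ false
    above-out = S≤⇒∉ (suc (suc m)) i (suc v) (trans (+-suc i (suc m)) (trans (cong suc diag) (sym (+-suc a v)))) ≤-refl

  maximal⇒peak : ∀ m v i → i + suc m ≡ a + v → Maximal Î i v → Peak word m v
  maximal⇒peak m v i diag (in-Î , right-out , above-out) =
    subst (Peak word m) (corner-count m v i diag S₀≡)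
      (occ-tabulated← (a + b) letter m (corner-in-range m v i diag (proj₂ (within i v in-Î)))
        (flat⇒letter m (trans S₁≡ (sym S₀≡))) (drop⇒letter (suc m) (trans (cong suc S₂≡) (sym S₁≡))))
    where
    i<S₁ : i < S (suc m)
    i<S₁ = ∈⇒<S (suc m) i v diag in-Î
    S₂≤i : S (suc (suc m)) ≤ i
    S₂≤i = ∉⇒S≤ (suc (suc m)) i (suc v) (trans (+-suc i (suc m)) (trans (cong suc diag) (sym (+-suc a v)))) above-out
    S₀≤ : S m ≤ suc i
    S₀≤ = ∉⇒S≤ m (suc i) v (trans (sym (+-suc i m)) diag) right-out
    S₁≡ : S (suc m) ≡ suc i
    S₁≡ = ≤-antisym (≤-trans (S-step (suc m)) (s≤s S₂≤i)) i<S₁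
    S₂≡ : S (suc (suc m)) ≡ i
    S₂≡ = ≤-antisym S₂≤i (≤-pred (≤-trans i<S₁ (S-step (suc m))))
    S₀≡ : S m ≡ suc i
    S₀≡ = ≤-antisym S₀≤ (subst (_≤ S m) S₁≡ (S-mono m))

  -- the lower neighbour (i - 1 , j) of a cell on the diagonal n + 1 lies on the
  -- diagonal n + 2, so it bounds S (n + 2)
  left⇒≤S : ∀ n i j → i + suc n ≡ a + j → (∀ k → i ≡ suc k → Î k j ≡ true) → i ≤ S (suc (suc n))
  left⇒≤S n zero j _ _ = z≤n
  left⇒≤S n (suc k) j diag left = ∈⇒<S (suc (suc n)) k j (trans (+-suc k (suc n)) diag) (left k refl)

  -- the lower neighbour (i , j - 1) of a cell on the diagonal n + 1 lies on the
  -- n-th diagonal (in a negative column when j = 0), so it bounds S n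
  under⇒<S : ∀ n i j → i + suc n ≡ a + j → (∀ l → j ≡ suc l → Î i l ≡ true) → i < S n
  under⇒<S n i zero diag _ =
    below⇒<S n i (≤-reflexive (trans (sym (+-suc i n)) (trans diag (+-identityʳ a))))
  under⇒<S n i (suc l) diag under =
    ∈⇒<S n i l (suc-injective (trans (sym (+-suc i n)) (trans diag (+-suc a l)))) (under l refl)

  -- Valleys of the word are the minimal elements of the complement: a
  -- valley at m after v trues is the cell (S (m + 1) , v).
  valley⇒minimal : ∀ m v → Valley word m v → Σ ℕ λ i → (i + suc m ≡ a + v) × MinimalOutside a b Î i v
  valley⇒minimal m v o with occ-tabulated→ (a + b) letter m v o
  ... | in-range , minus , plus , c =
    i , diag , i<a , v<b , out , below-corner Î down i v (left , under)
    where
    i = S (suc m)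
    drop : suc i ≡ S m
    drop = letter⇒drop m minus
    flat : S (suc (suc m)) ≡ i
    flat = letter⇒flat (suc m) plus
    diag : i + suc m ≡ a + v
    diag = corner-position m v i c (sym drop)
    i<a : i < a
    i<a = ≤-trans (≤-reflexive drop) (S≤a m)
    v<b : v < b
    v<b = begin-strict
      v                                ≡⟨ sym c ⟩
      count letter m                   ≡⟨ sym (count-false letter m minus) ⟩
      count letter (suc m)             <⟨ ≤-reflexive (sym (count-true letter (suc m) plus)) ⟩
      count letter (suc (suc m))       ≤⟨ count-mono letter in-range ⟩
      count letter (a + b)             ≡⟨ word-trues ⟩
      b                                ∎
      where open ≤-Reasoning
    out : Î i v ≡ false
    out = S≤⇒∉ (suc m) i v diag ≤-refl
    left : ∀ k → i ≡ suc k → Î k v ≡ true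
    left k i≡ = <S⇒∈ (suc (suc m)) k v (trans (+-suc k (suc m)) (trans (cong (_+ suc m) (sym i≡)) diag))
                  (≤-reflexive (trans (sym i≡) (sym flat)))
    under : ∀ l → v ≡ suc l → Î i l ≡ true
    under l v≡ = <S⇒∈ m i l (suc-injective (trans (sym (+-suc i m)) (trans diag (trans (cong (a +_) v≡) (+-suc a l)))))
                   (≤-reflexive drop)

  minimal⇒valley : ∀ m v i → i + suc m ≡ a + v → MinimalOutside a b Î i v → Valley word m v
  minimal⇒valley m v i diag min@(_ , v<b , out , _) =
    subst (Valley word m) (corner-count m v i diag S₀≡)
      (occ-tabulated← (a + b) letter m (corner-in-range m v i diag v<b)
        (drop⇒letter m (trans (cong suc S₁≡) (sym S₀≡))) (flat⇒letter (suc m) S₂≡))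
    where
    lower = minimal⇒lower Î i v min
    S₁≤i : S (suc m) ≤ i
    S₁≤i = ∉⇒S≤ (suc m) i v diag out
    i≤S₂ : i ≤ S (suc (suc m))
    i≤S₂ = left⇒≤S m i v diag (proj₁ lower)
    i<S₀ : i < S m
    i<S₀ = under⇒<S m i v diag (proj₂ lower)
    S₁≡ : S (suc m) ≡ i
    S₁≡ = ≤-antisym S₁≤i (≤-trans i≤S₂ (S-mono (suc m)))
    S₂≡ : S (suc (suc m)) ≡ S (suc m)
    S₂≡ = ≤-antisym (S-mono (suc m)) (≤-trans S₁≤i i≤S₂)
    S₀≡ : S m ≡ suc i
    S₀≡ = ≤-antisym (≤-trans (S-step m) (s≤s S₁≤i)) i<S₀

extend : ∀ {a b} → Subset a b → ℕ → ℕ → Bool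
extend {a} {b} I i j with i <? a | j <? b
... | yes i<a | yes j<b = I (fromℕ< i<a , fromℕ< j<b)
... | _ | _ = false

extend-fromℕ : ∀ {a b} (I : Subset a b) i j (i<a : i < a) (j<b : j < b) →
               extend I i j ≡ I (fromℕ< i<a , fromℕ< j<b)
extend-fromℕ {a} {b} I i j i<a j<b with i <? a | j <? b
... | yes i<a' | yes j<b' = cong₂ (λ x y → I (x , y)) (fromℕ<-cong i i refl i<a' i<a) (fromℕ<-cong j j refl j<b' j<b)
... | no i≮a | _ = ⊥-elim (i≮a i<a)
... | yes _ | no j≮b = ⊥-elim (j≮b j<b)

extend-toℕ : ∀ {a b} (I : Subset a b) x y → extend I (toℕ x) (toℕ y) ≡ I (x , y)
extend-toℕ I x y = trans (extend-fromℕ I _ _ (toℕ<n x) (toℕ<n y))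
  (cong₂ (λ x y → I (x , y)) (fromℕ<-toℕ x (toℕ<n x)) (fromℕ<-toℕ y (toℕ<n y)))

extend-within : ∀ {a b} (I : Subset a b) → Within a b (extend I)
extend-within {a} {b} I i j with i <? a | j <? b
... | yes i<a | yes j<b = λ _ → i<a , j<b
... | yes _ | no _ = λ ()
... | no _ | _ = λ ()

≤P⇒ : ∀ {a b} (x x' : Fin a) (y y' : Fin b) → ((x , y) ≤P (x' , y')) ≡ true →
      (toℕ x ≤ toℕ x') × (toℕ y ≤ toℕ y')
≤P⇒ x x' y y' e with ∧-true {toℕ x ≤ᵇ toℕ x'} e
... | e₁ , e₂ = ≤ᵇ⇒≤ _ _ (true⇒T e₁) , ≤ᵇ⇒≤ _ _ (true⇒T e₂)

⇒≤P : ∀ {a b} (x x' : Fin a) (y y' : Fin b) → toℕ x ≤ toℕ x' → toℕ y ≤ toℕ y' →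
      ((x , y) ≤P (x' , y')) ≡ true
⇒≤P x x' y y' x≤ y≤ rewrite T⇒true (≤⇒≤ᵇ x≤) | T⇒true (≤⇒≤ᵇ y≤) = refl

<P⇒ : ∀ {a b} (x x' : Fin a) (y y' : Fin b) → ((x , y) <P (x' , y')) ≡ true →
      (toℕ x ≤ toℕ x') × (toℕ y ≤ toℕ y') × ¬ ((toℕ x ≡ toℕ x') × (toℕ y ≡ toℕ y'))
<P⇒ x x' y y' e with ∧-true {(x , y) ≤P (x' , y')} e
... | e₁ , e₂ = proj₁ (≤P⇒ x x' y y' e₁) , proj₂ (≤P⇒ x x' y y' e₁) , distinct
  where
  distinct : ¬ ((toℕ x ≡ toℕ x') × (toℕ y ≡ toℕ y'))
  distinct (x≡ , y≡) with toℕ x ≟ toℕ x' | toℕ y ≟ toℕ y'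
  ... | yes _ | yes _ = true-false e₂ refl
  ... | no x≢ | _ = x≢ x≡
  ... | yes _ | no y≢ = y≢ y≡

⇒<P : ∀ {a b} (x x' : Fin a) (y y' : Fin b) → toℕ x ≤ toℕ x' → toℕ y ≤ toℕ y' →
      ¬ ((toℕ x ≡ toℕ x') × (toℕ y ≡ toℕ y')) → ((x , y) <P (x' , y')) ≡ true
⇒<P x x' y y' x≤ y≤ distinct rewrite ⇒≤P x x' y y' x≤ y≤ with toℕ x ≟ toℕ x' | toℕ y ≟ toℕ y'
... | yes x≡ | yes y≡ = ⊥-elim (distinct (x≡ , y≡))
... | yes _ | no _ = refl
... | no _ | _ = refl

∈-points : ∀ {a b} (p : Pt a b) → p ∈ points a b
∈-points {a} {b} (x , y) = ∈-concatMap⁺ (λ i → map (λ j → (i , j)) (allFin b))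
  (Any.map (λ { refl → ∈-map⁺ (λ j → (x , j)) (∈-allFin y) }) (∈-allFin x))

ideal⇒downClosed : ∀ {a b} (I : Subset a b) → IsOrderIdeal I → DownClosed (extend I)
ideal⇒downClosed I ideal i j i' j' i≤i' j≤j' in' with extend-within I i' j' in'
... | i'<a , j'<b = trans (extend-fromℕ I i j i<a j<b)
        (ideal (fromℕ< i'<a , fromℕ< j'<b) (fromℕ< i<a , fromℕ< j<b)
          (⇒≤P _ _ _ _ (subst₂ _≤_ (sym (toℕ-fromℕ< i<a)) (sym (toℕ-fromℕ< i'<a)) i≤i')
                       (subst₂ _≤_ (sym (toℕ-fromℕ< j<b)) (sym (toℕ-fromℕ< j'<b)) j≤j'))
          (trans (sym (extend-fromℕ I i' j' i'<a j'<b)) in'))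
  where
  i<a = ≤-<-trans i≤i' i'<a
  j<b = ≤-<-trans j≤j' j'<b

module Rowmotion {a b : ℕ} (I : Subset a b) where

  J : Subset a b
  J = rowmotion I

  minCompl⇒minimal : ∀ x y → isMinCompl I (x , y) ≡ true → MinimalOutside a b (extend I) (toℕ x) (toℕ y)
  minCompl⇒minimal x y e with ∧-true {not (I (x , y))} e
  ... | out , below = toℕ<n x , toℕ<n y , trans (extend-toℕ I x y) (¬-not λ in-I → true-false in-I (not-true out)) , lower
    where
    not-true : ∀ {z} → not z ≡ true → z ≡ false
    not-true {false} _ = refl
    lower : ∀ i j → i ≤ toℕ x → j ≤ toℕ y → ¬ ((i ≡ toℕ x) × (j ≡ toℕ y)) → extend I i j ≡ true
    lower i j i≤ j≤ distinct =
      trans (extend-fromℕ I i j i<a j<b)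
        (forced (T⇒true (All.lookup (all⁺ _ (points a b) (true⇒T below)) (∈-points p)))
          (⇒<P _ _ _ _ (subst (_≤ toℕ x) (sym (toℕ-fromℕ< i<a)) i≤) (subst (_≤ toℕ y) (sym (toℕ-fromℕ< j<b)) j≤)
            λ (x≡ , y≡) → distinct (trans (sym (toℕ-fromℕ< i<a)) x≡ , trans (sym (toℕ-fromℕ< j<b)) y≡)))
      where
      i<a = ≤-<-trans i≤ (toℕ<n x)
      j<b = ≤-<-trans j≤ (toℕ<n y)
      p = (fromℕ< i<a , fromℕ< j<b)
      forced : ∀ {c u} → (if c then u else true) ≡ true → c ≡ true → u ≡ true
      forced e refl = e

  minimal⇒minCompl : ∀ x y → MinimalOutside a b (extend I) (toℕ x) (toℕ y) → isMinCompl I (x , y) ≡ true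
  minimal⇒minCompl x y (_ , _ , out , lower) =
    cong₂ _∧_ (cong not (trans (sym (extend-toℕ I x y)) out))
      (T⇒true (all⁻ _ (All.tabulate {xs = points a b} λ {p} _ → true⇒T (below p))))
    where
    below : ∀ p → (if p <P (x , y) then I p else true) ≡ true
    below (x' , y') with (x' , y') <P (x , y) in lt
    ... | true with <P⇒ x' x y' y lt
    ...   | x≤ , y≤ , distinct = trans (sym (extend-toℕ I x' y')) (lower (toℕ x') (toℕ y') x≤ y≤ distinct)
    below (x' , y') | false = refl

  J⇒below-minimal : ∀ i j → extend J i j ≡ true →
                    Σ ℕ λ i' → Σ ℕ λ j' → MinimalOutside a b (extend I) i' j' × (i ≤ i') × (j ≤ j')
  J⇒below-minimal i j in-J with extend-within J i j in-J
  ... | i<a , j<b with satisfied (any⁻ _ (points a b) (true⇒T (trans (sym (extend-fromℕ J i j i<a j<b)) in-J)))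
  ... | (x , y) , generator with ∧-true {isMinCompl I (x , y)} (T⇒true generator)
  ... | minimal , below with ≤P⇒ (fromℕ< i<a) x (fromℕ< j<b) y below
  ... | i≤ , j≤ = toℕ x , toℕ y , minCompl⇒minimal x y minimal ,
                  subst (_≤ toℕ x) (toℕ-fromℕ< i<a) i≤ , subst (_≤ toℕ y) (toℕ-fromℕ< j<b) j≤

  below-minimal⇒J : ∀ i j i' j' → MinimalOutside a b (extend I) i' j' → i ≤ i' → j ≤ j' → extend J i j ≡ true
  below-minimal⇒J i j i' j' minimal@(i'<a , j'<b , _) i≤ j≤ =
    trans (extend-fromℕ J i j i<a j<b)
      (T⇒true (any⁺ _ (Any.map (λ { refl → true⇒T (cong₂ _∧_ generator below) }) (∈-points m))))
    where
    i<a = ≤-<-trans i≤ i'<a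
    j<b = ≤-<-trans j≤ j'<b
    m = (fromℕ< i'<a , fromℕ< j'<b)
    generator : isMinCompl I m ≡ true
    generator = minimal⇒minCompl (fromℕ< i'<a) (fromℕ< j'<b)
      (subst₂ (MinimalOutside a b (extend I)) (sym (toℕ-fromℕ< i'<a)) (sym (toℕ-fromℕ< j'<b)) minimal)
    below : ((fromℕ< i<a , fromℕ< j<b) ≤P m) ≡ true
    below = ⇒≤P _ _ _ _ (subst₂ _≤_ (sym (toℕ-fromℕ< i<a)) (sym (toℕ-fromℕ< i'<a)) i≤)
                        (subst₂ _≤_ (sym (toℕ-fromℕ< j<b)) (sym (toℕ-fromℕ< j'<b)) j≤)

  J-downClosed : DownClosed (extend J)
  J-downClosed i j i' j' i≤ j≤ in-J = shrink (J⇒below-minimal i' j' in-J)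
    where
    shrink : (Σ ℕ λ i'' → Σ ℕ λ j'' → MinimalOutside a b (extend I) i'' j'' × (i' ≤ i'') × (j' ≤ j'')) →
             extend J i j ≡ true
    shrink (i'' , j'' , minimal , i'≤ , j'≤) = below-minimal⇒J i j i'' j'' minimal (≤-trans i≤ i'≤) (≤-trans j≤ j'≤)

  maximal⇒minimal : ∀ i j → Maximal (extend J) i j → MinimalOutside a b (extend I) i j
  maximal⇒minimal i j (in-J , right-out , above-out) = corner (J⇒below-minimal i j in-J)
    where
    corner : (Σ ℕ λ i' → Σ ℕ λ j' → MinimalOutside a b (extend I) i' j' × (i ≤ i') × (j ≤ j')) →
             MinimalOutside a b (extend I) i j
    corner (i' , j' , minimal , i≤ , j≤) = subst₂ (MinimalOutside a b (extend I)) (sym i≡) (sym j≡) minimal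
      where
      i≡ : i ≡ i'
      i≡ with suc i ≤? i'
      ... | yes i<i' = ⊥-elim (true-false (below-minimal⇒J (suc i) j i' j' minimal i<i' j≤) right-out)
      ... | no i≮i' = ≤-antisym i≤ (≤-pred (≰⇒> i≮i'))
      j≡ : j ≡ j'
      j≡ with suc j ≤? j'
      ... | yes j<j' = ⊥-elim (true-false (below-minimal⇒J i (suc j) i' j' minimal i≤ j<j') above-out)
      ... | no j≮j' = ≤-antisym j≤ (≤-pred (≰⇒> j≮j'))

  minimal⇒maximal : ∀ i j → MinimalOutside a b (extend I) i j → Maximal (extend J) i j
  minimal⇒maximal i j minimal@(_ , _ , out , _) =
    below-minimal⇒J i j i j minimal ≤-refl ≤-refl ,
    ¬-not (λ in-J → right-in (J⇒below-minimal (suc i) j in-J)) ,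
    ¬-not (λ in-J → above-in (J⇒below-minimal i (suc j) in-J))
    where
    right-in : ¬ (Σ ℕ λ i' → Σ ℕ λ j' → MinimalOutside a b (extend I) i' j' × (suc i ≤ i') × (j ≤ j'))
    right-in (i' , j' , (_ , _ , _ , lower') , i<i' , j≤) =
      true-false (lower' i j (≤-trans (n≤1+n i) i<i') j≤ (λ (i≡ , _) → 1+n≰n (subst (suc i ≤_) (sym i≡) i<i'))) out
    above-in : ¬ (Σ ℕ λ i' → Σ ℕ λ j' → MinimalOutside a b (extend I) i' j' × (i ≤ i') × (suc j ≤ j'))
    above-in (i' , j' , (_ , _ , _ , lower') , i≤ , j<j') =
      true-false (lower' i j i≤ (≤-trans (n≤1+n j) j<j') (λ (_ , j≡) → 1+n≰n (subst (suc j ≤_) (sym j≡) j<j'))) out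

sum-concatMap : ∀ {A C : Set} (h : C → ℕ) (G : A → List C) xs →
                sum (map h (concatMap G xs)) ≡ sum (map (λ x → sum (map h (G x))) xs)
sum-concatMap h G [] = refl
sum-concatMap h G (x ∷ xs) = trans (cong sum (map-++ h (G x) (concatMap G xs)))
  (trans (sum-++ (map h (G x)) _) (cong (sum (map h (G x)) +_) (sum-concatMap h G xs)))

sum-allFin : ∀ n (f : ℕ → Bool) → sum (map (λ j → ind (f (toℕ j))) (allFin n)) ≡ count f n
sum-allFin n f = trans (cong sum (map-tabulate {n = n} (λ j → j) (λ j → ind (f (toℕ j))))) (sum-tabulate n f)
  where
  sum-tabulate : ∀ n (f : ℕ → Bool) → sum (tabulate {n = n} (λ j → ind (f (toℕ j)))) ≡ count f n
  sum-tabulate zero f = refl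
  sum-tabulate (suc n) f = cong (ind (f 0) +_) (sum-tabulate n (f ∘ suc))

module DiagonalTest where
  open ℤSolver.+-*-Solver using (solve; _:+_; _:-_; _:=_)

  shift-y : ∀ (x y a : ℤ) → (y ℤ.- x) ℤ.+ (x ℤ.+ a) ≡ a ℤ.+ y
  shift-y = solve 3 (λ x y a → ((y :- x) :+ (x :+ a)) := (a :+ y)) refl

  shift-n : ∀ (x n a : ℤ) → (n ℤ.- a) ℤ.+ (x ℤ.+ a) ≡ x ℤ.+ n
  shift-n = solve 3 (λ x n a → ((n :- a) :+ (x :+ a)) := (x :+ n)) refl

  unshift-y : ∀ (x y a : ℤ) → y ℤ.- x ≡ (a ℤ.+ y) ℤ.- (x ℤ.+ a)
  unshift-y = solve 3 (λ x y a → (y :- x) := ((a :+ y) :- (x :+ a))) refl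

  unshift-n : ∀ (x n a : ℤ) → (x ℤ.+ n) ℤ.- (x ℤ.+ a) ≡ n ℤ.- a
  unshift-n = solve 3 (λ x n a → ((x :+ n) :- (x :+ a)) := (n :- a)) refl

  on-diagonal : ∀ n a x y → ⌊ ℤ.+ y ℤ.- ℤ.+ x ℤ.≟ ℤ.+ n ℤ.- ℤ.+ a ⌋ ≡ (x + n ≡ᵇ a + y)
  on-diagonal n a x y with ℤ.+ y ℤ.- ℤ.+ x ℤ.≟ ℤ.+ n ℤ.- ℤ.+ a
  ... | yes e = sym (T⇒true (≡⇒≡ᵇ _ _ (+-injective (begin
        ℤ.+ x ℤ.+ ℤ.+ n                               ≡⟨ sym (shift-n (ℤ.+ x) (ℤ.+ n) (ℤ.+ a)) ⟩
        (ℤ.+ n ℤ.- ℤ.+ a) ℤ.+ (ℤ.+ x ℤ.+ ℤ.+ a)       ≡⟨ cong (ℤ._+ (ℤ.+ x ℤ.+ ℤ.+ a)) (sym e) ⟩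
        (ℤ.+ y ℤ.- ℤ.+ x) ℤ.+ (ℤ.+ x ℤ.+ ℤ.+ a)       ≡⟨ shift-y (ℤ.+ x) (ℤ.+ y) (ℤ.+ a) ⟩
        ℤ.+ a ℤ.+ ℤ.+ y                               ∎))))
    where open ≡-Reasoning
  ... | no e≢ = sym (¬-not λ t → e≢ (begin
        ℤ.+ y ℤ.- ℤ.+ x                               ≡⟨ unshift-y (ℤ.+ x) (ℤ.+ y) (ℤ.+ a) ⟩
        ℤ.+ (a + y) ℤ.- (ℤ.+ x ℤ.+ ℤ.+ a)             ≡⟨ cong (λ z → ℤ.+ z ℤ.- (ℤ.+ x ℤ.+ ℤ.+ a)) (sym (≡ᵇ⇒≡ _ _ (true⇒T t))) ⟩
        ℤ.+ (x + n) ℤ.- (ℤ.+ x ℤ.+ ℤ.+ a)             ≡⟨ unshift-n (ℤ.+ x) (ℤ.+ n) (ℤ.+ a) ⟩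
        ℤ.+ n ℤ.- ℤ.+ a                               ∎))
    where open ≡-Reasoning

+suc-minus : ∀ y → ℤ.+ suc y ℤ.- ℤ.+ y ≡ ℤ.+ 1
+suc-minus y = trans ([+m]-[+n]≡m⊖n (suc y) y) (trans (⊖-≥ (n≤1+n y)) (cong ℤ.+_ (m+n∸n≡m 1 y)))

+minus-suc : ∀ y → ℤ.+ y ℤ.- ℤ.+ suc y ≡ ℤ.-[1+ 0 ]
+minus-suc y = trans ([+m]-[+n]≡m⊖n y (suc y)) (trans (⊖-< (n<1+n y)) (cong (λ z → ℤ.- ℤ.+ z) (m+n∸n≡m 1 y)))

∣n-a∣+a : ∀ n a → ∣ ℤ.+ n ℤ.- ℤ.+ a ∣ + a ≡ n + 2 * (a ∸ n)
∣n-a∣+a n a with a ≤? n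
... | yes a≤n = begin
  ∣ ℤ.+ n ℤ.- ℤ.+ a ∣ + a   ≡⟨ cong (λ z → ∣ z ∣ + a) (trans ([+m]-[+n]≡m⊖n n a) (⊖-≥ a≤n)) ⟩
  n ∸ a + a                ≡⟨ m∸n+n≡m a≤n ⟩
  n                        ≡⟨ sym (+-identityʳ n) ⟩
  n + 2 * 0                ≡⟨ cong (λ z → n + 2 * z) (sym (m≤n⇒m∸n≡0 a≤n)) ⟩
  n + 2 * (a ∸ n)          ∎
  where open ≡-Reasoning
... | no a≰n = begin
  ∣ ℤ.+ n ℤ.- ℤ.+ a ∣ + a   ≡⟨ cong (_+ a) (trans (cong ∣_∣ ([+m]-[+n]≡m⊖n n a)) (∣⊖∣-< (≰⇒> a≰n))) ⟩
  (a ∸ n) + a              ≡⟨ cong ((a ∸ n) +_) (sym (m+[n∸m]≡n (<⇒≤ (≰⇒> a≰n)))) ⟩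
  (a ∸ n) + (n + (a ∸ n))  ≡⟨ solve 2 (λ d n → d :+ (n :+ d) := n :+ con 2 :* d) refl (a ∸ n) n ⟩
  n + 2 * (a ∸ n)          ∎
  where
  open ≡-Reasoning
  open +-*-Solver

module SignWord {a b : ℕ} (I : Subset a b) (down : DownClosed (extend I)) where
  open Profile a b (extend I) down (extend-within I) public

  row-count : ∀ n (diag : Pt a b → Bool) → (∀ x y → diag (x , y) ≡ (toℕ x + n ≡ᵇ a + toℕ y)) → ∀ x →
              sum (map (λ p → ind (I p ∧ diag p)) (map (λ j → (x , j)) (allFin b))) ≡ ind (OnDiagonal n (toℕ x))
  row-count n diag diag≡ x = begin
    sum (map (λ p → ind (I p ∧ diag p)) (map (λ j → (x , j)) (allFin b)))
      ≡⟨ cong sum (sym (map-∘ (allFin b))) ⟩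
    sum (map (λ j → ind (I (x , j) ∧ diag (x , j))) (allFin b))
      ≡⟨ cong sum (map-cong (λ y → cong ind (cong₂ _∧_ (sym (extend-toℕ I x y)) (diag≡ x y))) (allFin b)) ⟩
    sum (map (λ j → ind (extend I (toℕ x) (toℕ j) ∧ (toℕ x + n ≡ᵇ a + toℕ j))) (allFin b))
      ≡⟨ sum-allFin b _ ⟩
    count (λ j → extend I (toℕ x) j ∧ (toℕ x + n ≡ᵇ a + j)) b
      ≡⟨ row-on-diagonal n (toℕ x) ⟩
    ind (OnDiagonal n (toℕ x)) ∎
    where open ≡-Reasoning

  countDiag-profile : ∀ n → countDiag I (ℤ.+ n ℤ.- ℤ.+ a) ≡ count (OnDiagonal n) a
  countDiag-profile n = trans (sum-concatMap _ _ (allFin a))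
    (trans (cong sum (map-cong (row-count n _ (λ x y → DiagonalTest.on-diagonal n a (toℕ x) (toℕ y))) (allFin a)))
      (sum-allFin a (OnDiagonal n)))

  h : ℕ → ℕ
  h n = ∣ ℤ.+ n ℤ.- ℤ.+ a ∣ + 2 * countDiag I (ℤ.+ n ℤ.- ℤ.+ a)

  h-profile : ∀ n → h n + a ≡ n + 2 * S n
  h-profile n = begin
    ∣ ℤ.+ n ℤ.- ℤ.+ a ∣ + 2 * countDiag I (ℤ.+ n ℤ.- ℤ.+ a) + a
      ≡⟨ cong (λ c → ∣ ℤ.+ n ℤ.- ℤ.+ a ∣ + 2 * c + a) (countDiag-profile n) ⟩
    ∣ ℤ.+ n ℤ.- ℤ.+ a ∣ + 2 * C + a
      ≡⟨ solve 3 (λ A C a → A :+ con 2 :* C :+ a := (A :+ a) :+ con 2 :* C) refl ∣ ℤ.+ n ℤ.- ℤ.+ a ∣ C a ⟩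
    (∣ ℤ.+ n ℤ.- ℤ.+ a ∣ + a) + 2 * C
      ≡⟨ cong (_+ 2 * C) (∣n-a∣+a n a) ⟩
    n + 2 * (a ∸ n) + 2 * C
      ≡⟨ solve 3 (λ n d C → n :+ con 2 :* d :+ con 2 :* C := n :+ con 2 :* (d :+ C)) refl n (a ∸ n) C ⟩
    n + 2 * ((a ∸ n) + C)
      ≡⟨ cong (λ s → n + 2 * s) (sym (S-split n)) ⟩
    n + 2 * S n ∎
    where
    C = count (OnDiagonal n) a
    open ≡-Reasoning
    open +-*-Solver

  height-step : ∀ n → ℤ.+ h (suc n) ℤ.- ℤ.+ h n ≡ toZ (letter n)
  height-step n with letter n in e
  ... | true = trans (cong (λ z → ℤ.+ z ℤ.- ℤ.+ h n) up) (+suc-minus (h n))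
    where
    up : h (suc n) ≡ suc (h n)
    up = +-cancelʳ-≡ a _ _ (begin
      h (suc n) + a          ≡⟨ h-profile (suc n) ⟩
      suc n + 2 * S (suc n)  ≡⟨ cong (λ s → suc n + 2 * s) (letter⇒flat n e) ⟩
      suc (n + 2 * S n)      ≡⟨ cong suc (sym (h-profile n)) ⟩
      suc (h n + a)          ∎)
      where open ≡-Reasoning
  ... | false = trans (cong (λ z → ℤ.+ h (suc n) ℤ.- ℤ.+ z) down') (+minus-suc (h (suc n)))
    where
    down' : h n ≡ suc (h (suc n))
    down' = +-cancelʳ-≡ a _ _ (begin
      h n + a                      ≡⟨ h-profile n ⟩
      n + 2 * S n                  ≡⟨ cong (λ s → n + 2 * s) (sym (letter⇒drop n e)) ⟩
      n + 2 * suc (S (suc n))      ≡⟨ solve 2 (λ n s → n :+ con 2 :* (con 1 :+ s) := con 1 :+ ((con 1 :+ n) :+ con 2 :* s)) refl n (S (suc n)) ⟩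
      suc (suc n + 2 * S (suc n))  ≡⟨ cong suc (sym (h-profile (suc n))) ⟩
      suc (h (suc n) + a)          ∎)
      where
      open ≡-Reasoning
      open +-*-Solver

  signWord-profile : signWord a b I ≡ map toZ word
  signWord-profile = begin
    signWord a b I                       ≡⟨ map-cong height-step (upTo (a + b)) ⟩
    map (toZ ∘ letter) (upTo (a + b))     ≡⟨ map-∘ (upTo (a + b)) ⟩
    map toZ (map letter (upTo (a + b)))   ≡⟨ cong (map toZ) (map-applyUpTo (λ i → i) letter (a + b)) ⟩
    map toZ word                         ∎
    where open ≡-Reasoning

-- Rowmotion reverses blocks and gaps of the profile word: the peaks of the
-- word of ΦI are the maximal elements of ΦI, i.e. the minimal elements of
-- the complement of I, i.e. the valleys of the word of I, which are the
-- peaks of its block-gap reversal.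
rowmotion-word : ∀ {a b} (I : Subset a b) (ideal : IsOrderIdeal I) →
                 SignWord.word (rowmotion I) (Rowmotion.J-downClosed I) ≡ bgr (SignWord.word I (ideal⇒downClosed I ideal))
rowmotion-word {a} {b} I ideal = peaks-determine WJ.word (bgr WI.word) same-length same-trues to from
  where
  open Rowmotion I
  module WI = SignWord I (ideal⇒downClosed I ideal)
  module WJ = SignWord J J-downClosed
  bgr-peaks = peaks-of-bgr (blocks WI.word)
  same-length : length WJ.word ≡ length (bgr WI.word)
  same-length = trans WJ.word-length (sym (trans (length-bgrAcc [] WI.word) WI.word-length))
  same-trues : trues WJ.word ≡ trues (bgr WI.word)
  same-trues = trans WJ.word-trues (sym (trans (trues-bgrAcc [] WI.word) WI.word-trues))
  to : ∀ m v → Peak WJ.word m v → Peak (bgr WI.word) m v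
  to m v peak = let (i , diag , maximal) = WJ.peak⇒maximal m v peak in
    proj₂ bgr-peaks m v (WI.minimal⇒valley m v i diag (maximal⇒minimal i v maximal))
  from : ∀ m v → Peak (bgr WI.word) m v → Peak WJ.word m v
  from m v peak = let (i , diag , minimal) = WI.valley⇒minimal m v (proj₁ bgr-peaks m v peak) in
    WJ.maximal⇒peak m v i diag (minimal⇒maximal i v minimal)

lemma21 : (a b : ℕ) → a ≥ 1 → b ≥ 1 → (I : Subset a b) → IsOrderIdeal I →
          signWord a b (rowmotion I) ≡ blockGapReversal (signWord a b I)
lemma21 a b _ _ I ideal = begin
  signWord a b (rowmotion I)          ≡⟨ WJ.signWord-profile ⟩
  map toZ WJ.word                     ≡⟨ cong (map toZ) (rowmotion-word I ideal) ⟩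
  map toZ (bgr WI.word)               ≡⟨ toZ-bgrAcc [] WI.word ⟩
  bgrGo [] (map toZ WI.word)          ≡⟨ cong (bgrGo []) (sym WI.signWord-profile) ⟩
  blockGapReversal (signWord a b I)   ∎
  where
  open ≡-Reasoning
  module WI = SignWord I (ideal⇒downClosed I ideal)
  module WJ = SignWord (rowmotion I) (Rowmotion.J-downClosed I)
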